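{- Let $a,b$ be positive integers. For an N-position $(x,y)$ of $\mathrm{WYT}(a,b)$, there are at most two P-positions that are reachable from $(x,y)$ by a diagonal move.
   Context: Game $\mathrm{WYT}(a,b)$: positions are pairs $(x,y)$ of nonnegative integers; a move replaces $(x,y)$ by $(x-\epsilon,y-\delta)$ where $0\le\epsilon\le x$, $0\le\delta\le y$, $\epsilon+\delta>0$, and $|\epsilon-\delta|<a$ or $\min(\epsilon,\delta)<b$. A player unable to move loses. A move is diagonal if $|\epsilon-\delta|\le a-1$. P-positions are those from which the player to move loses under optimal play; N-positions the others. -}

module Defs where

open import Data.Nat using (ℕ; zero; suc; _+_; _∸_; _≤_; _<_; _⊓_; ∣_-_∣; _<ᵇ_)
open import Data.Bool using (Bool; true; false; not; _∧_; _∨_; T)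
open import Data.List using (List; upTo)
open import Data.Bool.ListAction using (any)
open import Data.Product using (_×_; _,_; ∃-syntax)
open import Data.Sum using (_⊎_)
open import Relation.Binary.PropositionalEquality using (_≡_)

Pos : Set
Pos = ℕ × ℕ

-- Boolean test: removing (ε , δ) is a legal move of WYT(a,b)
-- (ignoring the bounds ε ≤ x, δ ≤ y, which are enforced by enumeration):
-- ε + δ > 0 and ( |ε - δ| < a  or  min(ε,δ) < b ).
legalᵇ : ℕ → ℕ → ℕ → ℕ → Bool
legalᵇ a b ε δ = (0 <ᵇ (ε + δ)) ∧ ((∣ ε - δ ∣ <ᵇ a) ∨ ((ε ⊓ δ) <ᵇ b))

-- outcome a b fuel x y = true  iff  (x , y) is a P-position of WYT(a,b),
-- correct whenever fuel ≥ x + y (every move decreases x + y).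
-- A position is P iff no legal move leads to a P-position.
outcome : ℕ → ℕ → ℕ → ℕ → ℕ → Bool
outcome a b zero    x y = true
outcome a b (suc f) x y =
  not (any (λ ε → any (λ δ → legalᵇ a b ε δ ∧ outcome a b f (x ∸ ε) (y ∸ δ))
                      (upTo (suc y)))
           (upTo (suc x)))

IsP : ℕ → ℕ → Pos → Set
IsP a b (x , y) = T (outcome a b (x + y) x y)

IsN : ℕ → ℕ → Pos → Set
IsN a b (x , y) = T (not (outcome a b (x + y) x y))

-- A diagonal move of WYT(a,b) from p to q: q = (x - ε , y - δ) with
-- 0 ≤ ε ≤ x, 0 ≤ δ ≤ y, ε + δ > 0 and |ε - δ| ≤ a - 1.
-- (Such a move is automatically legal, since |ε - δ| < a for a ≥ 1.)
DiagMove : ℕ → Pos → Pos → Set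
DiagMove a (x , y) (x' , y') =
  ∃[ ε ] ∃[ δ ] (ε ≤ x × δ ≤ y × 0 < ε + δ × ∣ ε - δ ∣ ≤ a ∸ 1
                × x' ≡ x ∸ ε × y' ≡ y ∸ δ)

{-# OPTIONS --safe #-}
module Submission where

-- Write the P-positions reachable diagonally from (x , y) as (x ∸ ε , y ∸ δ) with
-- |ε − δ| < a, and call ε − δ their drift. No P-position is a legal move away from
-- another one. So if one of two such P-positions lies componentwise below the other,
-- their difference is not a diagonal move and their drifts differ by at least a. If
-- neither lies below the other, the corner they span is an N-position, and its
-- P-follower is a legal move away from one of them: either one component of that
-- move is short, or it is diagonal because the two drifts differ by at most 2a − 2.
-- Hence distinct such P-positions have drifts at least a apart, while all drifts
-- lie in an interval of length 2a − 2, which holds at most two of them.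

open import Defs
open import Data.Bool using (Bool; true; false; not; _∧_; T)
open import Data.Bool.ListAction using (any; or)
open import Data.Bool.Properties using (T-≡; T-∧; T-∨)
open import Data.Empty using (⊥; ⊥-elim)
open import Data.List using (upTo)
open import Data.List.Membership.Propositional using (find; lose)
open import Data.List.Membership.Propositional.Properties using (∈-upTo⁺; ∈-upTo⁻)
open import Data.List.Properties using (map-cong-local)
open import Data.List.Relation.Unary.All.Properties using (applyUpTo⁺₁)
open import Data.List.Relation.Unary.Any.Properties using (any⁺; any⁻)
open import Data.Nat
open import Data.Nat.Properties
open import Data.Nat.Tactic.RingSolver using (solve-∀)
open import Data.Product using (_×_; _,_; proj₁; proj₂; ∃-syntax)
open import Data.Sum using (_⊎_; inj₁; inj₂; swap)
open import Data.Unit using (tt)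
open import Function using (_∘_; Equivalence)
open import Relation.Binary.PropositionalEquality using (_≡_; refl; sym; trans; cong; cong₂; subst; subst₂)
open import Relation.Nullary using (¬_; yes; no)

T-not⇒¬T : ∀ {c} → T (not c) → ¬ T c
T-not⇒¬T {false} _ ()

¬T-not⇒T : ∀ {c} → ¬ T (not c) → T c
¬T-not⇒T {false} h = h tt
¬T-not⇒T {true}  _ = tt

any-cong-upTo : ∀ n {p q : ℕ → Bool} → (∀ {i} → i < n → p i ≡ q i) → any p (upTo n) ≡ any q (upTo n)
any-cong-upTo n p≗q = cong or (map-cong-local (applyUpTo⁺₁ _ n p≗q))

legalᵇ⇒0<+ : ∀ a b e d → T (legalᵇ a b e d) → 0 < e + d
legalᵇ⇒0<+ _ _ _ _ = <ᵇ⇒< 0 _ ∘ proj₁ ∘ Equivalence.to T-∧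

m∸o+n∸p<m+n : ∀ {m n o p} → o ≤ m → p ≤ n → 0 < o + p → (m ∸ o) + (n ∸ p) < m + n
m∸o+n∸p<m+n {m} {n} {suc o} {p} o≤m _ _ = +-mono-<-≤ (∸-monoʳ-< z<s o≤m) (m∸n≤m n p)
m∸o+n∸p<m+n {m} {n} {zero}  {suc p} _ p≤n _ = +-mono-≤-< (≤-refl {m}) (∸-monoʳ-< z<s p≤n)

outcome-fuel : ∀ a b x y {f g} → x + y ≤ f → x + y ≤ g → outcome a b f x y ≡ outcome a b g x y
outcome-fuel a b x    y    {zero}  {zero}  _ _ = refl
outcome-fuel a b zero zero {zero}  {suc g} _ _ = refl
outcome-fuel a b zero zero {suc f} {zero}  _ _ = refl
outcome-fuel a b x    y    {suc f} {suc g} x+y≤f x+y≤g =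
  cong not (any-cong-upTo (suc x) λ e<x → any-cong-upTo (suc y) λ d<y → step (s≤s⁻¹ e<x) (s≤s⁻¹ d<y))
  where
  step : ∀ {e d} → e ≤ x → d ≤ y →
         legalᵇ a b e d ∧ outcome a b f (x ∸ e) (y ∸ d) ≡ legalᵇ a b e d ∧ outcome a b g (x ∸ e) (y ∸ d)
  step {e} {d} e≤x d≤y with legalᵇ a b e d in legal
  ... | false = refl
  ... | true  = outcome-fuel a b _ _ (s≤s⁻¹ (<-≤-trans decrease x+y≤f)) (s≤s⁻¹ (<-≤-trans decrease x+y≤g))
    where
    decrease : (x ∸ e) + (y ∸ d) < x + y
    decrease = m∸o+n∸p<m+n e≤x d≤y (legalᵇ⇒0<+ a b e d (Equivalence.from T-≡ legal))

IsP⇒¬IsP-after-legal-move : ∀ {a b x y e d} → IsP a b (x , y) → e ≤ x → d ≤ y → T (legalᵇ a b e d) →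
                            ¬ IsP a b (x ∸ e , y ∸ d)
IsP⇒¬IsP-after-legal-move {a} {b} {x} {y} {e} {d} isP e≤x d≤y legal isP′ =
  T-not⇒¬T (subst T (outcome-fuel a b x y ≤-refl (n≤1+n (x + y))) isP)
    (any⁺ _ (lose (∈-upTo⁺ (s≤s e≤x)) (any⁺ _ (lose (∈-upTo⁺ (s≤s d≤y))
      (Equivalence.from T-∧ (legal , subst T (outcome-fuel a b _ _ ≤-refl x∸e+y∸d≤x+y) isP′))))))
  where
  x∸e+y∸d≤x+y : (x ∸ e) + (y ∸ d) ≤ x + y
  x∸e+y∸d≤x+y = +-mono-≤ (m∸n≤m x e) (m∸n≤m y d)

¬IsP⇒IsP-after-legal-move : ∀ {a b x y} → ¬ IsP a b (x , y) →
  ∃[ e ] ∃[ d ] (e ≤ x × d ≤ y × T (legalᵇ a b e d) × IsP a b (x ∸ e , y ∸ d))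
¬IsP⇒IsP-after-legal-move {a} {b} {x} {y} ¬isP
  with e , e∈ , moves-by-e ← find (any⁻ _ _ (¬T-not⇒T (¬isP ∘ subst T (outcome-fuel a b x y (n≤1+n (x + y)) ≤-refl))))
  with d , d∈ , move ← find (any⁻ _ _ moves-by-e)
  with legal , isP′ ← Equivalence.to T-∧ move
  = let e≤x = s≤s⁻¹ (∈-upTo⁻ e∈); d≤y = s≤s⁻¹ (∈-upTo⁻ d∈) in
    e , d , e≤x , d≤y , legal ,
    subst T (outcome-fuel a b _ _ (<⇒≤ (m∸o+n∸p<m+n e≤x d≤y (legalᵇ⇒0<+ a b e d legal))) ≤-refl) isP′

Near : ℕ → ℕ → ℕ → Set
Near k m n = m ≤ n + k × n ≤ m + k

∣m-n∣≤k⇒Near : ∀ k m n → ∣ m - n ∣ ≤ k → Near k m n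
∣m-n∣≤k⇒Near k zero    n       n≤k = z≤n , n≤k
∣m-n∣≤k⇒Near k (suc m) zero    m≤k = m≤k , z≤n
∣m-n∣≤k⇒Near k (suc m) (suc n) h   with m≤n+k , n≤m+k ← ∣m-n∣≤k⇒Near k m n h = s≤s m≤n+k , s≤s n≤m+k

Near⇒∣m-n∣≤k : ∀ k m n → Near k m n → ∣ m - n ∣ ≤ k
Near⇒∣m-n∣≤k k zero    n       (_ , n≤k) = n≤k
Near⇒∣m-n∣≤k k (suc m) zero    (m≤k , _) = m≤k
Near⇒∣m-n∣≤k k (suc m) (suc n) (s≤s m≤n+k , s≤s n≤m+k) = Near⇒∣m-n∣≤k k m n (m≤n+k , n≤m+k)

-- (ε′ − δ′) − (ε − δ) > k, stated without subtraction.
Far : ℕ → ℕ → ℕ → ℕ → ℕ → Set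
Far k ε δ ε′ δ′ = ε + δ′ + suc k ≤ ε′ + δ

Apart : ℕ → ℕ → ℕ → ℕ → ℕ → Set
Apart k ε δ ε′ δ′ = Far k ε δ ε′ δ′ ⊎ Far k ε′ δ′ ε δ

far-far-not-near : ∀ {k ε₁ δ₁ ε₂ δ₂ ε₃ δ₃} → Far k ε₁ δ₁ ε₂ δ₂ → Far k ε₂ δ₂ ε₃ δ₃ →
                   δ₁ ≤ ε₁ + k → ε₃ ≤ δ₃ + k → ⊥
far-far-not-near {k} {ε₁} {δ₁} {ε₂} {δ₂} {ε₃} {δ₃} far₁₂ far₂₃ δ₁≤ ε₃≤ = m+1+n≰m M (begin
  M + 2                                             ≡⟨ rearrange ε₁ δ₂ ε₂ δ₃ k ⟩
  (ε₁ + δ₂ + suc k) + (ε₂ + δ₃ + suc k)             ≤⟨ +-mono-≤ far₁₂ far₂₃ ⟩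
  (ε₂ + δ₁) + (ε₃ + δ₂)                             ≤⟨ +-mono-≤ (+-monoʳ-≤ ε₂ δ₁≤) (+-monoˡ-≤ δ₂ ε₃≤) ⟩
  M                                                 ∎)
  where
  open ≤-Reasoning
  M : ℕ
  M = (ε₂ + (ε₁ + k)) + ((δ₃ + k) + δ₂)
  rearrange : ∀ ε₁ δ₂ ε₂ δ₃ k →
    (ε₂ + (ε₁ + k)) + ((δ₃ + k) + δ₂) + 2 ≡ (ε₁ + δ₂ + suc k) + (ε₂ + δ₃ + suc k)
  rearrange = solve-∀

no-three-apart-near : ∀ {k ε₁ δ₁ ε₂ δ₂ ε₃ δ₃} → Near k ε₁ δ₁ → Near k ε₂ δ₂ → Near k ε₃ δ₃ →
  Apart k ε₁ δ₁ ε₂ δ₂ → Apart k ε₁ δ₁ ε₃ δ₃ → Apart k ε₂ δ₂ ε₃ δ₃ → ⊥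
no-three-apart-near (_ , δ₁≤) _ (ε₃≤ , _) (inj₁ f₁₂) _ (inj₁ f₂₃) = far-far-not-near f₁₂ f₂₃ δ₁≤ ε₃≤
no-three-apart-near (_ , δ₁≤) (ε₂≤ , _) _ (inj₁ f₁₂) (inj₁ f₁₃) (inj₂ f₃₂) = far-far-not-near f₁₃ f₃₂ δ₁≤ ε₂≤
no-three-apart-near _ (ε₂≤ , _) (_ , δ₃≤) (inj₁ f₁₂) (inj₂ f₃₁) (inj₂ f₃₂) = far-far-not-near f₃₁ f₁₂ δ₃≤ ε₂≤
no-three-apart-near _ (_ , δ₂≤) (ε₃≤ , _) (inj₂ f₂₁) (inj₁ f₁₃) _ = far-far-not-near f₂₁ f₁₃ δ₂≤ ε₃≤
no-three-apart-near (ε₁≤ , _) (_ , δ₂≤) _ (inj₂ f₂₁) (inj₂ f₃₁) (inj₁ f₂₃) = far-far-not-near f₂₃ f₃₁ δ₂≤ ε₁≤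
no-three-apart-near (ε₁≤ , _) _ (_ , δ₃≤) (inj₂ f₂₁) (inj₂ f₃₁) (inj₂ f₃₂) = far-far-not-near f₃₂ f₂₁ δ₃≤ ε₁≤

Far-step : ∀ {k} ε δ {e d} → d + suc k ≤ e → Far k ε δ (ε + e) (δ + d)
Far-step {k} ε δ {e} {d} d+k<e = begin
  ε + (δ + d) + suc k   ≡⟨ regroupˡ ε δ d (suc k) ⟩
  (ε + δ) + (d + suc k) ≤⟨ +-monoʳ-≤ (ε + δ) d+k<e ⟩
  (ε + δ) + e           ≡⟨ regroupʳ ε δ e ⟩
  ε + e + δ             ∎
  where
  open ≤-Reasoning
  regroupˡ : ∀ ε δ d k → ε + (δ + d) + k ≡ (ε + δ) + (d + k)
  regroupˡ = solve-∀
  regroupʳ : ∀ ε δ e → (ε + δ) + e ≡ ε + e + δ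
  regroupʳ = solve-∀

Far-step′ : ∀ {k} ε δ {e d} → e + suc k ≤ d → Far k (ε + e) (δ + d) ε δ
Far-step′ {k} ε δ {e} {d} e+k<d = begin
  ε + e + δ + suc k     ≡⟨ regroupˡ ε e δ (suc k) ⟩
  (ε + δ) + (e + suc k) ≤⟨ +-monoʳ-≤ (ε + δ) e+k<d ⟩
  (ε + δ) + d           ≡⟨ +-assoc ε δ d ⟩
  ε + (δ + d)           ∎
  where
  open ≤-Reasoning
  regroupˡ : ∀ ε e δ k → ε + e + δ + k ≡ (ε + δ) + (e + k)
  regroupˡ = solve-∀

-- The first two bounds give e + f ≤ 2k, the last two e + f ≥ 2k + 2.
crossed-bounds-absurd : ∀ k ε δ e f e₂ d₂ → δ + f ≤ ε + k → ε + e ≤ δ + k →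
                        d₂ + k < e + e₂ → e₂ + k < f + d₂ → ⊥
crossed-bounds-absurd k ε δ e f e₂ d₂ δ+f≤ ε+e≤ far₁ far₂ = m+1+n≰m M (begin
  M + 2                                               ≡⟨ rearrange e e₂ f d₂ ε δ k ⟩
  (suc (d₂ + k) + suc (e₂ + k)) + ((δ + f) + (ε + e)) ≤⟨ +-mono-≤ (+-mono-≤ far₁ far₂) (+-mono-≤ δ+f≤ ε+e≤) ⟩
  M                                                   ∎)
  where
  open ≤-Reasoning
  M : ℕ
  M = ((e + e₂) + (f + d₂)) + ((ε + k) + (δ + k))
  rearrange : ∀ e e₂ f d₂ ε δ k → ((e + e₂) + (f + d₂)) + ((ε + k) + (δ + k)) + 2
                                  ≡ (suc (d₂ + k) + suc (e₂ + k)) + ((δ + f) + (ε + e))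
  rearrange = solve-∀

m+n≤o⇒n≤o∸m : ∀ m {n o} → m + n ≤ o → n ≤ o ∸ m
m+n≤o⇒n≤o∸m m {n} {o} m+n≤o = m+n≤o⇒m≤o∸n n (subst (_≤ o) (+-comm m n) m+n≤o)

n≤o∸m⇒m+n≤o : ∀ {m n o} → m ≤ o → n ≤ o ∸ m → m + n ≤ o
n≤o∸m⇒m+n≤o {m} {n} {o} m≤o n≤o∸m = subst (_≤ o) (+-comm n m) (m≤o∸n⇒m+n≤o n m≤o n≤o∸m)

m<n⇒∃[o]m+1+o≡n : ∀ {m n} → m < n → ∃[ o ] m + suc o ≡ n
m<n⇒∃[o]m+1+o≡n {m} m<n with o , m+1+o≡n ← m≤n⇒∃[o]m+o≡n m<n = o , trans (+-suc m o) m+1+o≡n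

module WYT (A b : ℕ) where

  legalᵇ-short : ∀ e d → 0 < e + d → e ⊓ d < b → T (legalᵇ (suc A) b e d)
  legalᵇ-short _ _ pos short = Equivalence.from T-∧ (<⇒<ᵇ pos , Equivalence.from T-∨ (inj₂ (<⇒<ᵇ short)))

  legalᵇ-near : ∀ e d → 0 < e + d → Near A e d → T (legalᵇ (suc A) b e d)
  legalᵇ-near e d pos near =
    Equivalence.from T-∧ (<⇒<ᵇ pos , Equivalence.from T-∨ (inj₁ (<⇒<ᵇ (s≤s (Near⇒∣m-n∣≤k A e d near)))))

  legalᵇ⇒near⊎short : ∀ {e d} → T (legalᵇ (suc A) b e d) → Near A e d ⊎ e < b ⊎ d < b
  legalᵇ⇒near⊎short {e} {d} legal with Equivalence.to T-∨ (proj₂ (Equivalence.to T-∧ legal))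
  ... | inj₁ near = inj₁ (∣m-n∣≤k⇒Near A e d (s≤s⁻¹ (<ᵇ⇒< _ _ near)))
  ... | inj₂ short with ⊓-sel e d
  ...   | inj₁ e⊓d≡e = inj₂ (inj₁ (subst (_< b) e⊓d≡e (<ᵇ⇒< _ _ short)))
  ...   | inj₂ e⊓d≡d = inj₂ (inj₂ (subst (_< b) e⊓d≡d (<ᵇ⇒< _ _ short)))

  module Below (x y : ℕ) where

    P : ℕ → ℕ → Set
    P ε δ = IsP (suc A) b (x ∸ ε , y ∸ δ)

    data SameOrApart (ε δ ε′ δ′ : ℕ) : Set where
      same  : _≡_ {A = Pos} (x ∸ ε , y ∸ δ) (x ∸ ε′ , y ∸ δ′) → SameOrApart ε δ ε′ δ′
      apart : Apart A ε δ ε′ δ′ → SameOrApart ε δ ε′ δ′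

    SameOrApart-sym : ∀ {ε δ ε′ δ′} → SameOrApart ε δ ε′ δ′ → SameOrApart ε′ δ′ ε δ
    SameOrApart-sym (same q≡q′)    = same (sym q≡q′)
    SameOrApart-sym (apart q#q′) = apart (swap q#q′)

    P-step-illegal : ∀ ε δ e d → ε + e ≤ x → δ + d ≤ y → P ε δ → P (ε + e) (δ + d) →
                     ¬ T (legalᵇ (suc A) b e d)
    P-step-illegal ε δ e d ε+e≤x δ+d≤y Pεδ Pεδ′ legal =
      IsP⇒¬IsP-after-legal-move Pεδ (m+n≤o⇒n≤o∸m ε ε+e≤x) (m+n≤o⇒n≤o∸m δ δ+d≤y) legal
        (subst₂ (λ u v → IsP (suc A) b (u , v)) (sym (∸-+-assoc x ε e)) (sym (∸-+-assoc y δ d)) Pεδ′)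

    ¬P⇒P-step : ∀ {ε δ} → ε ≤ x → δ ≤ y → ¬ P ε δ →
      ∃[ e ] ∃[ d ] (ε + e ≤ x × δ + d ≤ y × T (legalᵇ (suc A) b e d) × P (ε + e) (δ + d))
    ¬P⇒P-step {ε} {δ} ε≤x δ≤y ¬Pεδ
      with e , d , e≤ , d≤ , legal , P′ ← ¬IsP⇒IsP-after-legal-move ¬Pεδ
      = e , d , n≤o∸m⇒m+n≤o ε≤x e≤ , n≤o∸m⇒m+n≤o δ≤y d≤ , legal ,
        subst₂ (λ u v → IsP (suc A) b (u , v)) (∸-+-assoc x ε e) (∸-+-assoc y δ d) P′

    P-step-apart : ∀ ε δ e d → ε + e ≤ x → δ + d ≤ y → P ε δ → P (ε + e) (δ + d) → 0 < e + d →
                   Apart A ε δ (ε + e) (δ + d)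
    P-step-apart ε δ e d ε+e≤x δ+d≤y Pεδ Pεδ′ pos with e ≤? d + A | d ≤? e + A
    ... | yes e≤d+A | yes d≤e+A =
      ⊥-elim (P-step-illegal ε δ e d ε+e≤x δ+d≤y Pεδ Pεδ′ (legalᵇ-near e d pos (e≤d+A , d≤e+A)))
    ... | no e≰d+A  | _         = inj₁ (Far-step ε δ (subst (_≤ e) (sym (+-suc d A)) (≰⇒> e≰d+A)))
    ... | yes _     | no d≰e+A  = inj₂ (Far-step′ ε δ (subst (_≤ d) (sym (+-suc e A)) (≰⇒> d≰e+A)))

    P-dominated : ∀ {ε δ ε′ δ′} → ε ≤ ε′ → δ ≤ δ′ → ε′ ≤ x → δ′ ≤ y → P ε δ → P ε′ δ′ →
                  SameOrApart ε δ ε′ δ′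
    P-dominated {ε} {δ} ε≤ε′ δ≤δ′ ε′≤x δ′≤y Pεδ Pεδ′
      with e , refl ← m≤n⇒∃[o]m+o≡n ε≤ε′ | d , refl ← m≤n⇒∃[o]m+o≡n δ≤δ′ | e | d
    ... | zero      | zero      =
      same (cong₂ _,_ (cong (x ∸_) (sym (+-identityʳ ε))) (cong (y ∸_) (sym (+-identityʳ δ))))
    ... | e@(suc _) | d         = apart (P-step-apart ε δ e d ε′≤x δ′≤y Pεδ Pεδ′ z<s)
    ... | zero      | d@(suc _) = apart (P-step-apart ε δ 0 d ε′≤x δ′≤y Pεδ Pεδ′ z<s)

    P-column-unique : b ≥ 1 → ∀ ε δ f → ε ≤ x → δ + f ≤ y → 0 < f → P ε δ → ¬ P ε (δ + f)
    P-column-unique b≥1 ε δ f ε≤x δ+f≤y 0<f Pεδ Pεδ′ =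
      P-step-illegal ε δ 0 f (subst (_≤ x) (sym (+-identityʳ ε)) ε≤x) δ+f≤y Pεδ
        (subst (λ u → P u (δ + f)) (sym (+-identityʳ ε)) Pεδ′) (legalᵇ-short 0 f 0<f b≥1)

    -- The corner (ε + e , δ + f) is not P, so it has a P-follower W; W is reachable
    -- from both given P-positions, and one of those two moves is legal.
    P-crossed : b ≥ 1 → ∀ ε δ e f → ε + e ≤ x → δ + f ≤ y → 0 < e → 0 < f →
                δ + f ≤ ε + A → ε + e ≤ δ + A → P ε (δ + f) → P (ε + e) δ → ⊥
    P-crossed b≥1 ε δ e f ε+e≤x δ+f≤y 0<e 0<f δ+f≤ ε+e≤ Pᵢ Pⱼ
      with e₂ , d₂ , ≤x , ≤y , legal , P-W
             ← ¬P⇒P-step ε+e≤x δ+f≤y (P-column-unique b≥1 (ε + e) δ f ε+e≤x δ+f≤y 0<f Pⱼ)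
      = refute (legalᵇ⇒near⊎short legal)
      where
      illegalᵢ : ¬ T (legalᵇ (suc A) b (e + e₂) d₂)
      illegalᵢ = P-step-illegal ε (δ + f) (e + e₂) d₂ (subst (_≤ x) (+-assoc ε e e₂) ≤x) ≤y Pᵢ
                   (subst (λ u → P u (δ + f + d₂)) (+-assoc ε e e₂) P-W)
      illegalⱼ : ¬ T (legalᵇ (suc A) b e₂ (f + d₂))
      illegalⱼ = P-step-illegal (ε + e) δ e₂ (f + d₂) ≤x (subst (_≤ y) (+-assoc δ f d₂) ≤y) Pⱼ
                   (subst (P (ε + e + e₂)) (+-assoc δ f d₂) P-W)
      0<ᵢ : 0 < (e + e₂) + d₂
      0<ᵢ = <-≤-trans 0<e (≤-trans (m≤m+n e e₂) (m≤m+n _ d₂))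
      0<ⱼ : 0 < e₂ + (f + d₂)
      0<ⱼ = <-≤-trans 0<f (≤-trans (m≤m+n f d₂) (m≤n+m _ e₂))
      refute : Near A e₂ d₂ ⊎ e₂ < b ⊎ d₂ < b → ⊥
      refute (inj₂ (inj₁ e₂<b)) = illegalⱼ (legalᵇ-short e₂ (f + d₂) 0<ⱼ (m<n⇒m⊓o<n _ e₂<b))
      refute (inj₂ (inj₂ d₂<b)) = illegalᵢ (legalᵇ-short (e + e₂) d₂ 0<ᵢ (m<n⇒o⊓m<n _ d₂<b))
      refute (inj₁ (e₂≤ , d₂≤)) with e + e₂ ≤? d₂ + A | f + d₂ ≤? e₂ + A
      ... | yes e+e₂≤ | _ =
        illegalᵢ (legalᵇ-near (e + e₂) d₂ 0<ᵢ (e+e₂≤ , ≤-trans d₂≤ (+-monoˡ-≤ A (m≤n+m e₂ e))))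
      ... | no _ | yes f+d₂≤ =
        illegalⱼ (legalᵇ-near e₂ (f + d₂) 0<ⱼ (≤-trans e₂≤ (+-monoˡ-≤ A (m≤n+m d₂ f)) , f+d₂≤))
      ... | no e+e₂≰ | no f+d₂≰ =
        crossed-bounds-absurd A ε δ e f e₂ d₂ δ+f≤ ε+e≤ (≰⇒> e+e₂≰) (≰⇒> f+d₂≰)

    P-pair-crossing : b ≥ 1 → ∀ {ε δ ε′ δ′} → ε ≤ ε′ → δ′ ≤ δ → ε′ ≤ x → δ ≤ y →
                      δ ≤ ε + A → ε′ ≤ δ′ + A → P ε δ → P ε′ δ′ → SameOrApart ε δ ε′ δ′
    P-pair-crossing b≥1 {ε} {δ} {ε′} {δ′} ε≤ε′ δ′≤δ ε′≤x δ≤y δ≤ε+A ε′≤δ′+A Pᵢ Pⱼ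
      with m≤n⇒m<n∨m≡n ε≤ε′ | m≤n⇒m<n∨m≡n δ′≤δ
    ... | inj₂ refl | _         = SameOrApart-sym (P-dominated ≤-refl δ′≤δ ε′≤x δ≤y Pⱼ Pᵢ)
    ... | inj₁ _    | inj₂ refl = P-dominated ε≤ε′ ≤-refl ε′≤x δ≤y Pᵢ Pⱼ
    ... | inj₁ ε<ε′ | inj₁ δ′<δ
      with e , refl ← m<n⇒∃[o]m+1+o≡n ε<ε′ | f , refl ← m<n⇒∃[o]m+1+o≡n δ′<δ
      = ⊥-elim (P-crossed b≥1 ε δ′ (suc e) (suc f) ε′≤x δ≤y z<s z<s δ≤ε+A ε′≤δ′+A Pᵢ Pⱼ)

    P-pair : b ≥ 1 → ∀ {ε δ ε′ δ′} → ε ≤ x → δ ≤ y → ε′ ≤ x → δ′ ≤ y → Near A ε δ → Near A ε′ δ′ →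
             P ε δ → P ε′ δ′ → SameOrApart ε δ ε′ δ′
    P-pair b≥1 {ε} {δ} {ε′} {δ′} ε≤x δ≤y ε′≤x δ′≤y (ε≤δ+A , δ≤ε+A) (ε′≤δ′+A , δ′≤ε′+A) Pᵢ Pⱼ
      with ≤-total ε ε′ | ≤-total δ δ′
    ... | inj₁ ε≤ε′ | inj₁ δ≤δ′ = P-dominated ε≤ε′ δ≤δ′ ε′≤x δ′≤y Pᵢ Pⱼ
    ... | inj₂ ε′≤ε | inj₂ δ′≤δ = SameOrApart-sym (P-dominated ε′≤ε δ′≤δ ε≤x δ≤y Pⱼ Pᵢ)
    ... | inj₁ ε≤ε′ | inj₂ δ′≤δ = P-pair-crossing b≥1 ε≤ε′ δ′≤δ ε′≤x δ≤y δ≤ε+A ε′≤δ′+A Pᵢ Pⱼ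
    ... | inj₂ ε′≤ε | inj₁ δ≤δ′ =
      SameOrApart-sym (P-pair-crossing b≥1 ε′≤ε δ≤δ′ ε≤x δ′≤y δ′≤ε′+A ε≤δ+A Pⱼ Pᵢ)

    two-of-three-same : ∀ {ε₁ δ₁ ε₂ δ₂ ε₃ δ₃} → Near A ε₁ δ₁ → Near A ε₂ δ₂ → Near A ε₃ δ₃ →
      SameOrApart ε₁ δ₁ ε₂ δ₂ → SameOrApart ε₁ δ₁ ε₃ δ₃ → SameOrApart ε₂ δ₂ ε₃ δ₃ →
      _≡_ {A = Pos} (x ∸ ε₁ , y ∸ δ₁) (x ∸ ε₂ , y ∸ δ₂) ⊎ _≡_ {A = Pos} (x ∸ ε₁ , y ∸ δ₁) (x ∸ ε₃ , y ∸ δ₃)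
        ⊎ _≡_ {A = Pos} (x ∸ ε₂ , y ∸ δ₂) (x ∸ ε₃ , y ∸ δ₃)
    two-of-three-same _ _ _ (same q₁≡q₂) _ _ = inj₁ q₁≡q₂
    two-of-three-same _ _ _ (apart _) (same q₁≡q₃) _ = inj₂ (inj₁ q₁≡q₃)
    two-of-three-same _ _ _ (apart _) (apart _) (same q₂≡q₃) = inj₂ (inj₂ q₂≡q₃)
    two-of-three-same near₁ near₂ near₃ (apart apart₁₂) (apart apart₁₃) (apart apart₂₃) =
      ⊥-elim (no-three-apart-near near₁ near₂ near₃ apart₁₂ apart₁₃ apart₂₃)

mainTheorem14 : (a b : ℕ) → a ≥ 1 → b ≥ 1 → (p : Pos) → IsN a b p →
    (q₁ q₂ q₃ : Pos) →
    DiagMove a p q₁ → IsP a b q₁ →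
    DiagMove a p q₂ → IsP a b q₂ →
    DiagMove a p q₃ → IsP a b q₃ →
    q₁ ≡ q₂ ⊎ q₁ ≡ q₃ ⊎ q₂ ≡ q₃
mainTheorem14 (suc A) b _ b≥1 (x , y) _ _ _ _
  (ε₁ , δ₁ , ε₁≤x , δ₁≤y , _ , ∣ε₁-δ₁∣≤A , refl , refl) P₁
  (ε₂ , δ₂ , ε₂≤x , δ₂≤y , _ , ∣ε₂-δ₂∣≤A , refl , refl) P₂
  (ε₃ , δ₃ , ε₃≤x , δ₃≤y , _ , ∣ε₃-δ₃∣≤A , refl , refl) P₃
  = two-of-three-same near₁ near₂ near₃
      (P-pair b≥1 ε₁≤x δ₁≤y ε₂≤x δ₂≤y near₁ near₂ P₁ P₂)
      (P-pair b≥1 ε₁≤x δ₁≤y ε₃≤x δ₃≤y near₁ near₃ P₁ P₃)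
      (P-pair b≥1 ε₂≤x δ₂≤y ε₃≤x δ₃≤y near₂ near₃ P₂ P₃)
  where
  open WYT A b
  open Below x y
  near₁ : Near A ε₁ δ₁
  near₁ = ∣m-n∣≤k⇒Near A ε₁ δ₁ ∣ε₁-δ₁∣≤A
  near₂ : Near A ε₂ δ₂
  near₂ = ∣m-n∣≤k⇒Near A ε₂ δ₂ ∣ε₂-δ₂∣≤A
  near₃ : Near A ε₃ δ₃
  near₃ = ∣m-n∣≤k⇒Near A ε₃ δ₃ ∣ε₃-δ₃∣≤A
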